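{- Let $\phi = \frac{1+\sqrt5}{2}$, $c(m) = \lfloor m\phi^2/2\rfloor$ and $\lambda = \frac{5-\sqrt5}{4}$. For every positive integer $n$, \[ \phi^3\{c(2n+1)\phi\} - \phi\{n\phi\} = \begin{cases} \phi^2, & \text{if } \{n\phi\} < \lambda,\\ 1, & \text{if } \{n\phi\} > \lambda.\end{cases} \]
   Context: $\{x\} = x - \lfloor x\rfloor$ denotes the fractional part. -}

module Defs where

open import Data.Integer using (ℤ; +_; _+_; _-_; _*_; -_; _<_; _≤_; 0ℤ; 1ℤ)
open import Data.Product using (_×_)
open import Data.Sum using (_⊎_)
open import Relation.Binary.PropositionalEquality using (_≡_)

-- The ring ℤ[φ] ⊂ ℝ, φ = (1+√5)/2, φ² = φ + 1.
-- ⟨ a , b ⟩ represents the real number a + b·φ.  Since φ is irrational,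
-- this representation is unique, so _≡_ on ℤφ is equality of reals.
record ℤφ : Set where
  constructor ⟨_,_⟩
  field
    re : ℤ
    im : ℤ
open ℤφ public

ι : ℤ → ℤφ
ι k = ⟨ k , 0ℤ ⟩

φ : ℤφ
φ = ⟨ 0ℤ , 1ℤ ⟩

infixl 6 _⊕_ _⊖_
infixl 7 _⊗_
infix 4 _<φ_ _≤φ_

_⊕_ : ℤφ → ℤφ → ℤφ
⟨ a , b ⟩ ⊕ ⟨ c , d ⟩ = ⟨ a + c , b + d ⟩

_⊖_ : ℤφ → ℤφ → ℤφ
⟨ a , b ⟩ ⊖ ⟨ c , d ⟩ = ⟨ a - c , b - d ⟩

-- (a + bφ)(c + dφ) = (ac + bd) + (ad + bc + bd)φ   using φ² = φ + 1
_⊗_ : ℤφ → ℤφ → ℤφ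
⟨ a , b ⟩ ⊗ ⟨ c , d ⟩ = ⟨ a * c + b * d , a * d + b * c + b * d ⟩

-- Positivity of the real number a + bφ = (p + q√5)/2 with p = 2a + b, q = b.
-- p + q√5 > 0  iff  (p ≥ 0, q ≥ 0, not both 0) or (p > 0 > q, p² > 5q²)
--                   or (p < 0 < q, 5q² > p²).
PosPQ : ℤ → ℤ → Set
PosPQ p q = (0ℤ ≤ p × 0ℤ ≤ q × 0ℤ < p + q)
          ⊎ ((0ℤ < p × q < 0ℤ) × (+ 5) * (q * q) < p * p)
          ⊎ ((p < 0ℤ × 0ℤ < q) × p * p < (+ 5) * (q * q))

Pos : ℤφ → Set
Pos ⟨ a , b ⟩ = PosPQ ((+ 2) * a + b) b

_<φ_ : ℤφ → ℤφ → Set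
x <φ y = Pos (y ⊖ x)

_≤φ_ : ℤφ → ℤφ → Set
x ≤φ y = x ≡ y ⊎ x <φ y

IsFloor : ℤφ → ℤ → Set
IsFloor x k = ι k ≤φ x × x <φ ι (k + 1ℤ)

IsFloorHalf : ℤφ → ℤ → Set
IsFloorHalf x k = ι ((+ 2) * k) ≤φ x × x <φ ι ((+ 2) * k + (+ 2))

module Submission where

-- Write f = {nφ} = nφ − j ∈ (0,1).  Since (2n+1)φ²/2 = n + j + f + φ²/2 and
-- φ²/2 + f < 2 exactly when 2f < 3 − φ, we get c = n + j + 1 below λ and
-- c = n + j + 2 above λ.  Substituting j = nφ − f turns cφ into
-- n + 2j + φ + (2 − φ)f, resp. n + 2j + 2φ + (2 − φ)f, so k = n + 2j + 1,
-- resp. k = n + 2j + 3, and both claims become identities in ℤ[φ].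
--
-- All comparisons take place in ℤ[√5]: a + bφ = (p + q√5)/2 with p = 2a + b,
-- q = b, and positivity is the predicate Cone p q.  Each floor hypothesis becomes two cone memberships;
-- sums of them whose √5-part cancels (certificates) give integer
-- inequalities pinning c and k.

open import Defs
open import Data.Nat using (ℕ; _≤_; suc; z≤n; s≤s)
open import Data.Integer
  using (ℤ; +_; -[1+_]; 0ℤ; 1ℤ; _+_; _*_; _-_; -_; _<_; +<+; +≤+; Positive)
  renaming (_≤_ to _≤ℤ_)
import Data.Integer.Properties as ℤP
open import Data.Integer.Tactic.RingSolver using (solve-∀)
open import Data.Product using (_×_; _,_; proj₁; proj₂)
open import Data.Sum using (_⊎_; inj₁; inj₂)
open import Data.Empty using (⊥; ⊥-elim)
open import Relation.Nullary using (¬_)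
open import Relation.Binary.PropositionalEquality
  using (_≡_; _≢_; refl; sym; trans; cong; cong₂; subst; subst₂)

infixl 1 _by_ _by≤_

_by_ : ∀ {x y} → 0ℤ < x → x ≡ y → 0ℤ < y
h by refl = h

_by≤_ : ∀ {x y} → 0ℤ ≤ℤ x → x ≡ y → 0ℤ ≤ℤ y
h by≤ refl = h

+-pos : ∀ {a b} → 0ℤ < a → 0ℤ < b → 0ℤ < a + b
+-pos = ℤP.+-mono-<

+-nonneg : ∀ {a b} → 0ℤ ≤ℤ a → 0ℤ ≤ℤ b → 0ℤ ≤ℤ a + b
+-nonneg = ℤP.+-mono-≤

+-nonneg-pos : ∀ {a b} → 0ℤ ≤ℤ a → 0ℤ < b → 0ℤ < a + b
+-nonneg-pos = ℤP.+-mono-≤-<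

+-pos-nonneg : ∀ {a b} → 0ℤ < a → 0ℤ ≤ℤ b → 0ℤ < a + b
+-pos-nonneg = ℤP.+-mono-<-≤

*-pos : ∀ {a b} → 0ℤ < a → 0ℤ < b → 0ℤ < a * b
*-pos (+<+ (s≤s z≤n)) (+<+ (s≤s z≤n)) = +<+ (s≤s z≤n)

*-nonneg : ∀ {a b} → 0ℤ ≤ℤ a → 0ℤ ≤ℤ b → 0ℤ ≤ℤ a * b
*-nonneg {+ m} {+ n} _ _ = +≤+ z≤n by≤ sym (ℤP.+◃n≡+n (m Data.Nat.* n))

square-nonneg : ∀ a → 0ℤ ≤ℤ a * a
square-nonneg (+ m) = +≤+ z≤n by≤ sym (ℤP.+◃n≡+n (m Data.Nat.* m))
square-nonneg -[1+ m ] = +≤+ z≤n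

pos⇒nonneg : ∀ {a} → 0ℤ < a → 0ℤ ≤ℤ a
pos⇒nonneg = ℤP.<⇒≤

positive : ∀ k .{{_ : Positive k}} → 0ℤ < k
positive k = ℤP.positive⁻¹ k

nonneg : ∀ n → 0ℤ ≤ℤ + n
nonneg n = +≤+ z≤n

<⇒0<- : ∀ {a b} → a < b → 0ℤ < b - a
<⇒0<- {a} {b} h = subst (_< b - a) (ℤP.+-inverseʳ a) (ℤP.+-monoˡ-< (- a) h)

pos-or-nonpos : ∀ x → 0ℤ < x ⊎ 0ℤ ≤ℤ - x
pos-or-nonpos (+ suc n) = inj₁ (+<+ (s≤s z≤n))
pos-or-nonpos (+ 0) = inj₂ (+≤+ z≤n)
pos-or-nonpos -[1+ n ] = inj₂ (+≤+ z≤n)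

nonneg-or-neg : ∀ x → 0ℤ ≤ℤ x ⊎ 0ℤ < - x
nonneg-or-neg (+ n) = inj₁ (+≤+ z≤n)
nonneg-or-neg -[1+ n ] = inj₂ (+<+ (s≤s z≤n))

discrete : ∀ y → 0ℤ < y + 1ℤ → 0ℤ ≤ℤ y
discrete (+ n) _ = +≤+ z≤n
discrete -[1+ 0 ] (+<+ ())
discrete -[1+ suc n ] ()

nonneg+pos≢0 : ∀ {x y} → 0ℤ ≤ℤ x → 0ℤ < y → x + y ≢ 0ℤ
nonneg+pos≢0 hx hy e = ℤP.<-irrefl refl (+-nonneg-pos hx hy by e)

*-cancel-pos : ∀ {c x} → 0ℤ < c → 0ℤ < c * x → 0ℤ < x
*-cancel-pos {c} {x} hc hcx with pos-or-nonpos x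
... | inj₁ hx = hx
... | inj₂ hx = ⊥-elim (nonneg+pos≢0 (*-nonneg (pos⇒nonneg hc) hx) hcx (e c x))
  where
  e : ∀ c x → c * (- x) + c * x ≡ 0ℤ
  e = solve-∀

pin : ∀ x a → 0ℤ < a + 1ℤ - x → 0ℤ < x - a + 1ℤ → x ≡ a
pin x a upper lower =
  ℤP.≤-antisym (ℤP.0≤i-j⇒j≤i (discrete (a - x) (upper by e₁ x a)))
               (ℤP.0≤i-j⇒j≤i (discrete (x - a) lower))
  where
  e₁ : ∀ x a → a + 1ℤ - x ≡ a - x + 1ℤ
  e₁ = solve-∀

square-mono : ∀ {a b} → 0ℤ ≤ℤ a → 0ℤ ≤ℤ b - a → 0ℤ ≤ℤ b * b - a * a
square-mono {a} {b} ha hba = *-nonneg hba (+-nonneg (+-nonneg hba ha) ha) by≤ e a b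
  where
  e : ∀ a b → (b - a) * (b - a + a + a) ≡ b * b - a * a
  e = solve-∀

square-mono-< : ∀ {a b} → 0ℤ ≤ℤ a → 0ℤ < b - a → 0ℤ < b * b - a * a
square-mono-< {a} {b} ha hba = *-pos hba (+-pos-nonneg (+-pos-nonneg hba ha) ha) by e a b
  where
  e : ∀ a b → (b - a) * (b - a + a + a) ≡ b * b - a * a
  e = solve-∀

square-cancel-< : ∀ {a b} → 0ℤ ≤ℤ a → 0ℤ ≤ℤ b → 0ℤ < b * b - a * a → 0ℤ < b - a
square-cancel-< {a} {b} ha hb h with pos-or-nonpos (b - a)
... | inj₁ hba = hba
... | inj₂ hab = ⊥-elim (nonneg+pos≢0 (*-nonneg hab (+-nonneg ha hb)) h (e a b))
  where
  e : ∀ a b → (- (b - a)) * (a + b) + (b * b - a * a) ≡ 0ℤ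
  e = solve-∀

*-mono-< : ∀ {a b c d} → 0ℤ ≤ℤ a → 0ℤ < b - a → 0ℤ ≤ℤ c → 0ℤ < d - c
         → 0ℤ < b * d - a * c
*-mono-< {a} {b} {c} {d} ha hba hc hdc =
  +-pos-nonneg (*-pos hba (+-pos-nonneg hdc hc)) (*-nonneg ha (pos⇒nonneg hdc)) by e a b c d
  where
  e : ∀ a b c d → (b - a) * (d - c + c) + a * (d - c) ≡ b * d - a * c
  e = solve-∀

-- The positive cone of ℤ[√5]: Cone p q means p + q√5 > 0.  It is split by
-- the signs of p and q; in the mixed cases p² is compared with 5q².
Cone⁺⁺ Cone⁺⁻ Cone⁻⁺ Cone : ℤ → ℤ → Set
Cone⁺⁺ p q = 0ℤ ≤ℤ p × 0ℤ ≤ℤ q × 0ℤ < p + q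
Cone⁺⁻ p q = 0ℤ < p × 0ℤ < - q × 0ℤ < p * p - + 5 * (q * q)
Cone⁻⁺ p q = 0ℤ < - p × 0ℤ < q × 0ℤ < + 5 * (q * q) - p * p
Cone p q = Cone⁺⁺ p q ⊎ Cone⁺⁻ p q ⊎ Cone⁻⁺ p q

fromPosPQ : ∀ {p q} → PosPQ p q → Cone p q
fromPosPQ (inj₁ h) = inj₁ h
fromPosPQ (inj₂ (inj₁ ((hp , hq) , h))) =
  inj₂ (inj₁ (hp , ℤP.neg-mono-< hq , <⇒0<- h))
fromPosPQ (inj₂ (inj₂ ((hp , hq) , h))) =
  inj₂ (inj₂ (ℤP.neg-mono-< hp , hq , <⇒0<- h))

cone-cong : ∀ {p q p′ q′} → Cone p q → p ≡ p′ → q ≡ q′ → Cone p′ q′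
cone-cong h refl refl = h

commute : ∀ {p q r t} → Cone (r + p) (t + q) → Cone (p + r) (q + t)
commute {p} {q} {r} {t} h = cone-cong h (ℤP.+-comm r p) (ℤP.+-comm t q)

add⁺⁺⁺⁺ : ∀ {p q r t} → Cone⁺⁺ p q → Cone⁺⁺ r t → Cone (p + r) (q + t)
add⁺⁺⁺⁺ {p} {q} {r} {t} (hp , hq , hpq) (hr , ht , hrt) =
  inj₁ (+-nonneg hp hr , +-nonneg hq ht , (+-pos hpq hrt by e p q r t))
  where
  e : ∀ p q r t → p + q + (r + t) ≡ p + r + (q + t)
  e = solve-∀

-- Adding x ≥ 0 to a Cone⁺⁻ element y: if the sum is still Cone⁺⁻, its
-- rational part only grew and its irrational part only shrank in size.
add⁺⁺⁺⁻ : ∀ {p q r t} → Cone⁺⁺ p q → Cone⁺⁻ r t → Cone (p + r) (q + t)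
add⁺⁺⁺⁻ {p} {q} {r} {t} (hp , hq , _) (hr , ht , h) with nonneg-or-neg (q + t)
... | inj₁ hv = inj₁ (pos⇒nonneg hu , hv , +-pos-nonneg hu hv)
  where
  hu = +-nonneg-pos hp hr
... | inj₂ hv = inj₂ (inj₁ (+-nonneg-pos hp hr , hv , main))
  where
  e₁ : ∀ q t → q ≡ (- t) - (- (q + t))
  e₁ = solve-∀
  e₂ : ∀ p r → p ≡ (p + r) - r
  e₂ = solve-∀
  e₃ : ∀ p q r t
     → ((p + r) * (p + r) - r * r)
       + ((r * r - + 5 * (t * t)) + + 5 * ((- t) * (- t) - (- (q + t)) * (- (q + t))))
       ≡ (p + r) * (p + r) - + 5 * ((q + t) * (q + t))
  e₃ = solve-∀
  smaller = square-mono { - (q + t)} { - t} (pos⇒nonneg hv) (hq by≤ e₁ q t)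
  larger = square-mono {r} {p + r} (pos⇒nonneg hr) (hp by≤ e₂ p r)
  main = +-nonneg-pos larger (+-pos-nonneg h (*-nonneg (nonneg 5) smaller)) by e₃ p q r t

-- The mirror image of add⁺⁺⁺⁻, with the roles of p and q√5 exchanged.
add⁺⁺⁻⁺ : ∀ {p q r t} → Cone⁺⁺ p q → Cone⁻⁺ r t → Cone (p + r) (q + t)
add⁺⁺⁻⁺ {p} {q} {r} {t} (hp , hq , _) (hr , ht , h) with nonneg-or-neg (p + r)
... | inj₁ hu = inj₁ (hu , pos⇒nonneg hv , +-nonneg-pos hu hv)
  where
  hv = +-nonneg-pos hq ht
... | inj₂ hu = inj₂ (inj₂ (hu , +-nonneg-pos hq ht , main))
  where
  e₁ : ∀ p r → p ≡ (- r) - (- (p + r))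
  e₁ = solve-∀
  e₂ : ∀ q t → q ≡ (q + t) - t
  e₂ = solve-∀
  e₃ : ∀ p q r t
     → + 5 * ((q + t) * (q + t) - t * t)
       + ((+ 5 * (t * t) - r * r) + ((- r) * (- r) - (- (p + r)) * (- (p + r))))
       ≡ + 5 * ((q + t) * (q + t)) - (p + r) * (p + r)
  e₃ = solve-∀
  smaller = square-mono { - (p + r)} { - r} (pos⇒nonneg hu) (hp by≤ e₁ p r)
  larger = square-mono {t} {q + t} (pos⇒nonneg ht) (hq by≤ e₂ q t)
  main = +-nonneg-pos (*-nonneg (nonneg 5) larger) (+-pos-nonneg h smaller) by e₃ p q r t

-- Two Cone⁺⁻ elements: besides p² > 5q² and r² > 5t² we need the cross
-- term pr > 5qt, obtained by multiplying the two inequalities.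
add⁺⁻⁺⁻ : ∀ {p q r t} → Cone⁺⁻ p q → Cone⁺⁻ r t → Cone (p + r) (q + t)
add⁺⁻⁺⁻ {p} {q} {r} {t} (hp , hq , h₁) (hr , ht , h₂) =
  inj₂ (inj₁ (+-pos hp hr , (+-pos hq ht by e₀ q t) , main))
  where
  e₀ : ∀ q t → - q + - t ≡ - (q + t)
  e₀ = solve-∀
  e₁ : ∀ q t → (- q) * (- t) ≡ q * t
  e₁ = solve-∀
  e₂ : ∀ p q r t → p * p * (r * r) - + 5 * (q * q) * (+ 5 * (t * t))
                 ≡ (p * r) * (p * r) - (+ 5 * (q * t)) * (+ 5 * (q * t))
  e₂ = solve-∀
  e₃ : ∀ p q r t
     → (p * p - + 5 * (q * q)) + (r * r - + 5 * (t * t)) + + 2 * (p * r - + 5 * (q * t))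
       ≡ (p + r) * (p + r) - + 5 * ((q + t) * (q + t))
  e₃ = solve-∀
  product = *-mono-< {+ 5 * (q * q)} {p * p} {+ 5 * (t * t)} {r * r}
              (*-nonneg (nonneg 5) (square-nonneg q)) h₁ (*-nonneg (nonneg 5) (square-nonneg t)) h₂
  cross = square-cancel-< {+ 5 * (q * t)} {p * r}
            (*-nonneg (nonneg 5) (pos⇒nonneg (*-pos hq ht) by≤ e₁ q t))
            (pos⇒nonneg (*-pos hp hr)) (product by e₂ p q r t)
  main = +-pos (+-pos h₁ h₂) (*-pos (positive (+ 2)) cross) by e₃ p q r t

add⁻⁺⁻⁺ : ∀ {p q r t} → Cone⁻⁺ p q → Cone⁻⁺ r t → Cone (p + r) (q + t)
add⁻⁺⁻⁺ {p} {q} {r} {t} (hp , hq , h₁) (hr , ht , h₂) =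
  inj₂ (inj₂ ((+-pos hp hr by e₀ p r) , +-pos hq ht , main))
  where
  e₀ : ∀ p r → - p + - r ≡ - (p + r)
  e₀ = solve-∀
  e₁ : ∀ p r → (- p) * (- r) ≡ p * r
  e₁ = solve-∀
  e₂ : ∀ p q r t → + 5 * (q * q) * (+ 5 * (t * t)) - p * p * (r * r)
                 ≡ (+ 5 * (q * t)) * (+ 5 * (q * t)) - (p * r) * (p * r)
  e₂ = solve-∀
  e₃ : ∀ p q r t
     → (+ 5 * (q * q) - p * p) + (+ 5 * (t * t) - r * r) + + 2 * (+ 5 * (q * t) - p * r)
       ≡ + 5 * ((q + t) * (q + t)) - (p + r) * (p + r)
  e₃ = solve-∀
  product = *-mono-< {p * p} {+ 5 * (q * q)} {r * r} {+ 5 * (t * t)}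
              (square-nonneg p) h₁ (square-nonneg r) h₂
  cross = square-cancel-< {p * r} {+ 5 * (q * t)}
            (pos⇒nonneg (*-pos hp hr) by≤ e₁ p r)
            (*-nonneg (nonneg 5) (pos⇒nonneg (*-pos hq ht))) (product by e₂ p q r t)
  main = +-pos (+-pos h₁ h₂) (*-pos (positive (+ 2)) cross) by e₃ p q r t

-- For x = p + q√5 ∈ Cone⁺⁻ and y = r + t√5 ∈ Cone⁻⁺ we have pt > rq: the
-- squares satisfy (pt)² − (rq)² = (p² − 5q²)t² + (5t² − r²)q² > 0.
cross-inequality : ∀ {p q r t} → Cone⁺⁻ p q → Cone⁻⁺ r t → 0ℤ < p * t - r * q
cross-inequality {p} {q} {r} {t} (hp , hq , h₁) (hr , ht , h₂) =
  square-cancel-< {r * q} {p * t} (pos⇒nonneg (*-pos hr hq) by≤ e₁ r q) (pos⇒nonneg (*-pos hp ht))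
    (+-pos (*-pos h₁ (*-pos ht ht)) (*-pos h₂ (*-pos hq hq)) by e₂ p q r t)
  where
  e₁ : ∀ q t → (- q) * (- t) ≡ q * t
  e₁ = solve-∀
  e₂ : ∀ p q r t → (p * p - + 5 * (q * q)) * (t * t) + (+ 5 * (t * t) - r * r) * ((- q) * (- q))
                 ≡ (p * t) * (p * t) - (r * q) * (r * q)
  e₂ = solve-∀

-- The sum of x ∈ Cone⁺⁻ and y ∈ Cone⁻⁺ with p + r > 0 > q + t lies in
-- Cone⁺⁻: by the cross inequality ((p + r)q)² > (p(q + t))², which with
-- p² > 5q² gives (p + r)² > 5(q + t)² after cancelling q².
sum-in-Cone⁺⁻ : ∀ {p q r t} → Cone⁺⁻ p q → Cone⁻⁺ r t
              → 0ℤ < p + r → 0ℤ < - (q + t) → Cone⁺⁻ (p + r) (q + t)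
sum-in-Cone⁺⁻ {p} {q} {r} {t} x@(hp , hq , h₁) y hu hv =
  hu , hv , *-cancel-pos (*-pos hq hq) (+-pos-nonneg squares rest by e′ p q r t)
  where
  e : ∀ p q r t → p * t - r * q ≡ (p + r) * (- q) - p * (- (q + t))
  e = solve-∀
  e′ : ∀ p q r t
     → ((p + r) * (- q) * ((p + r) * (- q)) - p * (- (q + t)) * (p * (- (q + t))))
       + (p * p - + 5 * (q * q)) * ((q + t) * (q + t))
       ≡ ((- q) * (- q)) * ((p + r) * (p + r) - + 5 * ((q + t) * (q + t)))
  e′ = solve-∀
  squares = square-mono-< {p * (- (q + t))} {(p + r) * (- q)}
              (*-nonneg (pos⇒nonneg hp) (pos⇒nonneg hv)) (cross-inequality x y by e p q r t)
  rest = *-nonneg (pos⇒nonneg h₁) (square-nonneg (q + t))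

sum-in-Cone⁻⁺ : ∀ {p q r t} → Cone⁺⁻ p q → Cone⁻⁺ r t
              → 0ℤ < - (p + r) → 0ℤ < q + t → Cone⁻⁺ (p + r) (q + t)
sum-in-Cone⁻⁺ {p} {q} {r} {t} x y@(hr , ht , h₂) hu hv =
  hu , hv , *-cancel-pos (*-pos ht ht) (+-pos-nonneg squares rest by e′ p q r t)
  where
  e : ∀ p q r t → p * t - r * q ≡ (- r) * (q + t) - (- (p + r)) * t
  e = solve-∀
  e′ : ∀ p q r t
     → ((- r) * (q + t) * ((- r) * (q + t)) - (- (p + r)) * t * ((- (p + r)) * t))
       + (+ 5 * (t * t) - r * r) * ((q + t) * (q + t))
       ≡ (t * t) * (+ 5 * ((q + t) * (q + t)) - (p + r) * (p + r))
  e′ = solve-∀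
  squares = square-mono-< {(- (p + r)) * t} {(- r) * (q + t)}
              (*-nonneg (pos⇒nonneg hu) (pos⇒nonneg ht)) (cross-inequality x y by e p q r t)
  rest = *-nonneg (pos⇒nonneg h₂) (square-nonneg (q + t))

-- The sum of x ∈ Cone⁺⁻ and y ∈ Cone⁻⁺ cannot have p + r ≤ 0 and
-- q + t ≤ 0: then p² ≤ r² and t² ≤ q², against p² > 5q² and 5t² > r².
sum-not-nonpos : ∀ {p q r t} → Cone⁺⁻ p q → Cone⁻⁺ r t
               → 0ℤ ≤ℤ - (p + r) → 0ℤ ≤ℤ - (q + t) → ⊥
sum-not-nonpos {p} {q} {r} {t} (hp , hq , h₁) (hr , ht , h₂) nu nv =
  nonneg+pos≢0 (+-nonneg (*-nonneg (nonneg 5) t²≤q²) p²≤r²) (+-pos h₁ h₂) (e p q r t)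
  where
  e : ∀ p q r t → (+ 5 * ((- q) * (- q) - t * t) + ((- r) * (- r) - p * p))
                  + ((p * p - + 5 * (q * q)) + (+ 5 * (t * t) - r * r)) ≡ 0ℤ
  e = solve-∀
  e₁ : ∀ p r → - (p + r) ≡ (- r) - p
  e₁ = solve-∀
  e₂ : ∀ q t → - (q + t) ≡ (- q) - t
  e₂ = solve-∀
  p²≤r² = square-mono {p} { - r} (pos⇒nonneg hp) (nu by≤ e₁ p r)
  t²≤q² = square-mono {t} { - q} (pos⇒nonneg ht) (nv by≤ e₂ q t)

add⁺⁻⁻⁺ : ∀ {p q r t} → Cone⁺⁻ p q → Cone⁻⁺ r t → Cone (p + r) (q + t)
add⁺⁻⁻⁺ {p} {q} {r} {t} x y with pos-or-nonpos (p + r) | nonneg-or-neg (q + t)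
... | inj₁ hu | inj₁ hv = inj₁ (pos⇒nonneg hu , hv , +-pos-nonneg hu hv)
... | inj₁ hu | inj₂ hv = inj₂ (inj₁ (sum-in-Cone⁺⁻ x y hu hv))
... | inj₂ nu | _ with pos-or-nonpos (q + t)
...   | inj₂ nv = ⊥-elim (sum-not-nonpos x y nu nv)
...   | inj₁ hv with nonneg-or-neg (p + r)
...     | inj₁ hu = inj₁ (hu , pos⇒nonneg hv , +-nonneg-pos hu hv)
...     | inj₂ hu = inj₂ (inj₂ (sum-in-Cone⁻⁺ x y hu hv))

infixl 6 _⊞_
_⊞_ : ∀ {p q r t} → Cone p q → Cone r t → Cone (p + r) (q + t)
inj₁ x ⊞ inj₁ y = add⁺⁺⁺⁺ x y
inj₁ x ⊞ inj₂ (inj₁ y) = add⁺⁺⁺⁻ x y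
inj₁ x ⊞ inj₂ (inj₂ y) = add⁺⁺⁻⁺ x y
inj₂ (inj₁ x) ⊞ inj₂ (inj₁ y) = add⁺⁻⁺⁻ x y
inj₂ (inj₁ x) ⊞ inj₂ (inj₂ y) = add⁺⁻⁻⁺ x y
inj₂ (inj₂ x) ⊞ inj₂ (inj₂ y) = add⁻⁺⁻⁺ x y
_⊞_ {p} {q} {r} {t} (inj₂ (inj₁ x)) (inj₁ y) = commute {p} {q} {r} {t} (add⁺⁺⁺⁻ y x)
_⊞_ {p} {q} {r} {t} (inj₂ (inj₂ x)) (inj₁ y) = commute {p} {q} {r} {t} (add⁺⁺⁻⁺ y x)
_⊞_ {p} {q} {r} {t} (inj₂ (inj₂ x)) (inj₂ (inj₁ y)) = commute {p} {q} {r} {t} (add⁺⁻⁻⁺ y x)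

scale : ∀ k .{{_ : Positive k}} {p q} → Cone p q → Cone (k * p) (k * q)
scale k {p} {q} (inj₁ (hp , hq , h)) =
  inj₁ (*-nonneg hk hp , *-nonneg hk hq , (*-pos (positive k) h by e k p q))
  where
  hk = pos⇒nonneg (positive k)
  e : ∀ k p q → k * (p + q) ≡ k * p + k * q
  e = solve-∀
scale k {p} {q} (inj₂ (inj₁ (hp , hq , h))) =
  inj₂ (inj₁ (*-pos (positive k) hp , (*-pos (positive k) hq by e₁ k q) ,
              (*-pos (*-pos (positive k) (positive k)) h by e₂ k p q)))
  where
  e₁ : ∀ k q → k * (- q) ≡ - (k * q)
  e₁ = solve-∀
  e₂ : ∀ k p q → k * k * (p * p - + 5 * (q * q)) ≡ k * p * (k * p) - + 5 * (k * q * (k * q))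
  e₂ = solve-∀
scale k {p} {q} (inj₂ (inj₂ (hp , hq , h))) =
  inj₂ (inj₂ ((*-pos (positive k) hp by e₁ k p) , *-pos (positive k) hq ,
              (*-pos (*-pos (positive k) (positive k)) h by e₂ k p q)))
  where
  e₁ : ∀ k p → k * (- p) ≡ - (k * p)
  e₁ = solve-∀
  e₂ : ∀ k p q → k * k * (+ 5 * (q * q) - p * p) ≡ + 5 * (k * q * (k * q)) - k * p * (k * p)
  e₂ = solve-∀

-- Multiplication by √5 − 1 = 2/φ, i.e. (p + q√5)(√5 − 1) = (5q − p) + (p − q)√5,
-- for p, q ≥ 0: the sign pattern of the product depends on how p compares
-- with q and with 5q.
times-√5-1⁺⁺ : ∀ {p q} → Cone⁺⁺ p q → Cone (+ 5 * q - p) (p - q)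
times-√5-1⁺⁺ {p} {q} (hp , hq , hpq) with nonneg-or-neg (p - q)
... | inj₂ q>p = inj₂ (inj₁ ((+-nonneg-pos (*-nonneg (nonneg 4) hq) q>p by e₁ p q) , q>p , main))
  where
  e₁ : ∀ p q → + 4 * q + - (p - q) ≡ + 5 * q - p
  e₁ = solve-∀
  e₂ : ∀ p q → - (p - q) ≡ q - p
  e₂ = solve-∀
  e₃ : ∀ p q → + 16 * (q * q) + + 4 * (q * q - p * p)
             ≡ (+ 5 * q - p) * (+ 5 * q - p) - + 5 * ((p - q) * (p - q))
  e₃ = solve-∀
  q²>p² = square-mono-< {p} {q} hp (q>p by e₂ p q)
  main = +-nonneg-pos (*-nonneg (nonneg 16) (square-nonneg q)) (*-pos (positive (+ 4)) q²>p²) by e₃ p q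
... | inj₁ p≥q with nonneg-or-neg (+ 5 * q - p)
...   | inj₂ p>5q = inj₂ (inj₂ (p>5q , (+-pos-nonneg p>5q (*-nonneg (nonneg 4) hq) by e₁ p q) , main))
  where
  e₁ : ∀ p q → - (+ 5 * q - p) + + 4 * q ≡ p - q
  e₁ = solve-∀
  e₂ : ∀ p q → - (+ 5 * q - p) ≡ p - + 5 * q
  e₂ = solve-∀
  e₃ : ∀ p q → + 4 * ((p * p - (+ 5 * q) * (+ 5 * q)) + + 20 * (q * q))
             ≡ + 5 * ((p - q) * (p - q)) - (+ 5 * q - p) * (+ 5 * q - p)
  e₃ = solve-∀
  p²>25q² = square-mono-< {+ 5 * q} {p} (*-nonneg (nonneg 5) hq) (p>5q by e₂ p q)
  main = *-pos (positive (+ 4)) (+-pos-nonneg p²>25q² (*-nonneg (nonneg 20) (square-nonneg q))) by e₃ p q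
...   | inj₁ 5q≥p = inj₁ (5q≥p , p≥q , *-cancel-pos (positive (+ 6)) sum>0)
  where
  e : ∀ p q → + 4 * (+ 5 * q - p) + + 4 * (p + q) ≡ + 6 * (+ 5 * q - p + (p - q))
  e = solve-∀
  sum>0 = +-nonneg-pos (*-nonneg (nonneg 4) 5q≥p) (*-pos (positive (+ 4)) hpq) by e p q
times-√5-1 : ∀ {p q} → Cone p q → Cone (+ 5 * q - p) (p - q)
times-√5-1 (inj₁ x) = times-√5-1⁺⁺ x
times-√5-1 {p} {q} (inj₂ (inj₁ (hp , hq , h))) =
  inj₂ (inj₂ ((+-pos hp (*-pos (positive (+ 5)) hq) by e₁ p q) , (+-pos hp hq by e₂ p q) ,
              (*-pos (positive (+ 4)) h by e₃ p q)))
  where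
  e₁ : ∀ p q → p + + 5 * (- q) ≡ - (+ 5 * q - p)
  e₁ = solve-∀
  e₂ : ∀ p q → p + - q ≡ p - q
  e₂ = solve-∀
  e₃ : ∀ p q → + 4 * (p * p - + 5 * (q * q)) ≡ + 5 * ((p - q) * (p - q)) - (+ 5 * q - p) * (+ 5 * q - p)
  e₃ = solve-∀
times-√5-1 {p} {q} (inj₂ (inj₂ (hp , hq , h))) =
  inj₂ (inj₁ ((+-pos (*-pos (positive (+ 5)) hq) hp by e₁ p q) , (+-pos hq hp by e₂ p q) ,
              (*-pos (positive (+ 4)) h by e₃ p q)))
  where
  e₁ : ∀ p q → + 5 * q + - p ≡ + 5 * q - p
  e₁ = solve-∀
  e₂ : ∀ p q → q + - p ≡ - (p - q)
  e₂ = solve-∀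
  e₃ : ∀ p q → + 4 * (+ 5 * (q * q) - p * p) ≡ (+ 5 * q - p) * (+ 5 * q - p) - + 5 * ((p - q) * (p - q))
  e₃ = solve-∀

integer : ∀ k .{{_ : Positive k}} → Cone k 0ℤ
integer k = inj₁ (pos⇒nonneg (positive k) , nonneg 0 , (positive k by sym (ℤP.+-identityʳ k)))

√5-2 : Cone (- + 2) (+ 1)
√5-2 = inj₂ (inj₂ (positive (+ 2) , positive (+ 1) , positive (+ 1)))

√5-1 : Cone (- + 1) (+ 1)
√5-1 = inj₂ (inj₂ (positive (+ 1) , positive (+ 1) , positive (+ 4)))

3-√5 : Cone (+ 3) (- + 1)
3-√5 = inj₂ (inj₁ (positive (+ 3) , positive (+ 1) , positive (+ 4)))

not-both-negative : ∀ {p q} → 0ℤ < - p → 0ℤ < - q → ¬ Cone p q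
not-both-negative {p} hp hq (inj₁ (p≥0 , _ , _)) = nonneg+pos≢0 p≥0 hp (ℤP.+-inverseʳ p)
not-both-negative {p} hp hq (inj₂ (inj₁ (p>0 , _ , _))) = nonneg+pos≢0 (pos⇒nonneg p>0) hp (ℤP.+-inverseʳ p)
not-both-negative {q = q} hp hq (inj₂ (inj₂ (_ , q>0 , _))) = nonneg+pos≢0 (pos⇒nonneg q>0) hq (ℤP.+-inverseʳ q)

rational : ∀ {d} → Cone d 0ℤ → 0ℤ < d
rational {d} (inj₁ (_ , _ , h)) = h by ℤP.+-identityʳ d
rational (inj₂ (inj₁ (_ , +<+ () , _)))
rational (inj₂ (inj₂ (_ , +<+ () , _)))

certificate : ∀ m .{{_ : Positive m}} {p q d} → Cone p q → p ≡ m * d → q ≡ 0ℤ → 0ℤ < d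
certificate m h p≡md q≡0 = *-cancel-pos (positive m) (rational (cone-cong h p≡md q≡0))

-- k = ⌊mφ⌋ with m ≠ 0, so that mφ is irrational: mφ − k > 0 and k + 1 − mφ > 0.
floor-mφ : ∀ {m k} → m ≢ 0ℤ → IsFloor (ι m ⊗ φ) k
         → Cone (m - + 2 * k) m × Cone (+ 2 * k + + 2 - m) (- m)
floor-mφ {m} {k} m≢0 (inj₁ k≡mφ , _) = ⊥-elim (m≢0 (trans (sym (e m)) (sym (cong im k≡mφ))))
  where
  e : ∀ m → m * 1ℤ + 0ℤ * 0ℤ + 0ℤ * 1ℤ ≡ m
  e = solve-∀
floor-mφ {m} {k} _ (inj₂ lower , upper) =
  cone-cong (fromPosPQ lower) (p₁ m k) (q₁ m) , cone-cong (fromPosPQ upper) (p₂ m k) (q₂ m)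
  where
  p₁ : ∀ m k → + 2 * ((m * 0ℤ + 0ℤ * 1ℤ) - k) + ((m * 1ℤ + 0ℤ * 0ℤ + 0ℤ * 1ℤ) - 0ℤ) ≡ m - + 2 * k
  p₁ = solve-∀
  q₁ : ∀ m → (m * 1ℤ + 0ℤ * 0ℤ + 0ℤ * 1ℤ) - 0ℤ ≡ m
  q₁ = solve-∀
  p₂ : ∀ m k → + 2 * ((k + 1ℤ) - (m * 0ℤ + 0ℤ * 1ℤ)) + (0ℤ - (m * 1ℤ + 0ℤ * 0ℤ + 0ℤ * 1ℤ))
             ≡ + 2 * k + + 2 - m
  p₂ = solve-∀
  q₂ : ∀ m → 0ℤ - (m * 1ℤ + 0ℤ * 0ℤ + 0ℤ * 1ℤ) ≡ - m
  q₂ = solve-∀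

floorHalf-mφ² : ∀ {m c} → m ≢ 0ℤ → IsFloorHalf (ι m ⊗ (φ ⊗ φ)) c
              → Cone (+ 3 * m - + 4 * c) m × Cone (+ 4 * c + + 4 - + 3 * m) (- m)
floorHalf-mφ² {m} {c} m≢0 (inj₁ 2c≡mφ² , _) = ⊥-elim (m≢0 (trans (sym (e m)) (sym (cong im 2c≡mφ²))))
  where
  e : ∀ m → m * 1ℤ + 0ℤ * 1ℤ + 0ℤ * 1ℤ ≡ m
  e = solve-∀
floorHalf-mφ² {m} {c} _ (inj₂ lower , upper) =
  cone-cong (fromPosPQ lower) (p₁ m c) (q₁ m) , cone-cong (fromPosPQ upper) (p₂ m c) (q₂ m)
  where
  p₁ : ∀ m c → + 2 * ((m * 1ℤ + 0ℤ * 1ℤ) - + 2 * c) + ((m * 1ℤ + 0ℤ * 1ℤ + 0ℤ * 1ℤ) - 0ℤ)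
             ≡ + 3 * m - + 4 * c
  p₁ = solve-∀
  q₁ : ∀ m → (m * 1ℤ + 0ℤ * 1ℤ + 0ℤ * 1ℤ) - 0ℤ ≡ m
  q₁ = solve-∀
  p₂ : ∀ m c → + 2 * ((+ 2 * c + + 2) - (m * 1ℤ + 0ℤ * 1ℤ)) + (0ℤ - (m * 1ℤ + 0ℤ * 1ℤ + 0ℤ * 1ℤ))
             ≡ + 4 * c + + 4 - + 3 * m
  p₂ = solve-∀
  q₂ : ∀ m → 0ℤ - (m * 1ℤ + 0ℤ * 1ℤ + 0ℤ * 1ℤ) ≡ - m
  q₂ = solve-∀

fractional : ∀ m k → ι m ⊗ φ ⊖ ι k ≡ ⟨ - k , m ⟩
fractional m k = cong₂ ⟨_,_⟩ (e₁ m k) (e₂ m)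
  where
  e₁ : ∀ m k → (m * 0ℤ + 0ℤ * 1ℤ) - k ≡ - k
  e₁ = solve-∀
  e₂ : ∀ m → (m * 1ℤ + 0ℤ * 0ℤ + 0ℤ * 1ℤ) - 0ℤ ≡ m
  e₂ = solve-∀

-- Comparing 2(a + bφ) with 3 − φ, i.e. a + bφ with λ = (3 − φ)/2.
twice-below-3-φ : ∀ {a b} → ι (+ 2) ⊗ ⟨ a , b ⟩ <φ ι (+ 3) ⊖ φ
                → Cone (+ 5 - + 4 * a - + 2 * b) (- (+ 2 * b + 1ℤ))
twice-below-3-φ {a} {b} h = cone-cong (fromPosPQ h) (p a b) (q a b)
  where
  p : ∀ a b → + 2 * (+ 3 - (+ 2 * a + 0ℤ * b)) + (- 1ℤ - (+ 2 * b + 0ℤ * a + 0ℤ * b))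
            ≡ + 5 - + 4 * a - + 2 * b
  p = solve-∀
  q : ∀ a b → - 1ℤ - (+ 2 * b + 0ℤ * a + 0ℤ * b) ≡ - (+ 2 * b + 1ℤ)
  q = solve-∀

twice-above-3-φ : ∀ {a b} → ι (+ 3) ⊖ φ <φ ι (+ 2) ⊗ ⟨ a , b ⟩
                → Cone (- (+ 5 - + 4 * a - + 2 * b)) (+ 2 * b + 1ℤ)
twice-above-3-φ {a} {b} h = cone-cong (fromPosPQ h) (p a b) (q a b)
  where
  p : ∀ a b → + 2 * ((+ 2 * a + 0ℤ * b) - + 3) + ((+ 2 * b + 0ℤ * a + 0ℤ * b) - - 1ℤ)
            ≡ - (+ 5 - + 4 * a - + 2 * b)
  p = solve-∀
  q : ∀ a b → (+ 2 * b + 0ℤ * a + 0ℤ * b) - - 1ℤ ≡ + 2 * b + 1ℤ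
  q = solve-∀

-- c ≥ 1: for c = 0 both coordinates of 2c + 2 − (2n+1)φ² would be negative.
c≢0 : ∀ {N C} → 0ℤ < N → Cone (+ 4 * C + + 4 - + 3 * (+ 2 * N + 1ℤ)) (- (+ 2 * N + 1ℤ)) → C ≢ 0ℤ
c≢0 {N} N>0 h refl = not-both-negative rational-part<0 irrational-part<0 h
  where
  e₁ : ∀ N → N ≡ N - 1ℤ + 1ℤ
  e₁ = solve-∀
  e₂ : ∀ N → + 6 * (N - 1ℤ) + + 5 ≡ - (+ 4 * 0ℤ + + 4 - + 3 * (+ 2 * N + 1ℤ))
  e₂ = solve-∀
  e₃ : ∀ N → + 2 * N + 1ℤ ≡ - - (+ 2 * N + 1ℤ)
  e₃ = solve-∀
  N≥1 = discrete (N - 1ℤ) (N>0 by e₁ N)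
  rational-part<0 = +-nonneg-pos (*-nonneg (nonneg 6) N≥1) (positive (+ 5)) by e₂ N
  irrational-part<0 = +-pos (*-pos (positive (+ 2)) N>0) (positive (+ 1)) by e₃ N

-- Parameters: n and j = ⌊nφ⌋ through the cone
-- coordinates of 0 < nφ − j < 1.  Each bound is a certificate: a sum of
-- hypotheses, multiples of constants and, for k, the bounds on nφ − j
-- multiplied by (√5 − 1)² = 4/φ², in which √5 cancels.
module Pinning (N J : ℤ) (frac>0 : Cone (N - + 2 * J) N) (frac<1 : Cone (+ 2 * J + + 2 - N) (- N)) where

  c-below-λ : ∀ C
    → Cone (+ 3 * (+ 2 * N + 1ℤ) - + 4 * C) (+ 2 * N + 1ℤ)
      × Cone (+ 4 * C + + 4 - + 3 * (+ 2 * N + 1ℤ)) (- (+ 2 * N + 1ℤ))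
    → Cone (+ 5 - + 4 * (- J) - + 2 * N) (- (+ 2 * N + 1ℤ))
    → C ≡ N + J + 1ℤ
  c-below-λ C (h1a , h1b) hA =
    pin C (N + J + 1ℤ) (certificate (+ 4) (h1a ⊞ hA) (p₁ N J C) (q₁ N))
                       (certificate (+ 4) (h1b ⊞ scale (+ 2) frac>0 ⊞ √5-2 ⊞ integer (+ 1)) (p₂ N J C) (q₂ N))
    where
    p₁ : ∀ N J C → (+ 3 * (+ 2 * N + 1ℤ) - + 4 * C) + (+ 5 - + 4 * (- J) - + 2 * N)
                 ≡ + 4 * (N + J + 1ℤ + 1ℤ - C)
    p₁ = solve-∀
    q₁ : ∀ N → (+ 2 * N + 1ℤ) + - (+ 2 * N + 1ℤ) ≡ 0ℤ
    q₁ = solve-∀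
    p₂ : ∀ N J C → (+ 4 * C + + 4 - + 3 * (+ 2 * N + 1ℤ)) + + 2 * (N - + 2 * J) + - + 2 + + 1
                 ≡ + 4 * (C - (N + J + 1ℤ) + 1ℤ)
    p₂ = solve-∀
    q₂ : ∀ N → - (+ 2 * N + 1ℤ) + + 2 * N + + 1 + 0ℤ ≡ 0ℤ
    q₂ = solve-∀

  c-above-λ : ∀ C
    → Cone (+ 3 * (+ 2 * N + 1ℤ) - + 4 * C) (+ 2 * N + 1ℤ)
      × Cone (+ 4 * C + + 4 - + 3 * (+ 2 * N + 1ℤ)) (- (+ 2 * N + 1ℤ))
    → Cone (- (+ 5 - + 4 * (- J) - + 2 * N)) (+ 2 * N + 1ℤ)
    → C ≡ N + J + + 2
  c-above-λ C (h1a , h1b) hB =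
    pin C (N + J + + 2) (certificate (+ 4) (h1a ⊞ scale (+ 2) frac<1 ⊞ 3-√5 ⊞ integer (+ 2)) (p₁ N J C) (q₁ N))
                        (certificate (+ 4) (h1b ⊞ hB) (p₂ N J C) (q₂ N))
    where
    p₁ : ∀ N J C → (+ 3 * (+ 2 * N + 1ℤ) - + 4 * C) + + 2 * (+ 2 * J + + 2 - N) + + 3 + + 2
                 ≡ + 4 * (N + J + + 2 + 1ℤ - C)
    p₁ = solve-∀
    q₁ : ∀ N → (+ 2 * N + 1ℤ) + + 2 * (- N) + - + 1 + 0ℤ ≡ 0ℤ
    q₁ = solve-∀
    p₂ : ∀ N J C → (+ 4 * C + + 4 - + 3 * (+ 2 * N + 1ℤ)) + - (+ 5 - + 4 * (- J) - + 2 * N)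
                 ≡ + 4 * (C - (N + J + + 2) + 1ℤ)
    p₂ = solve-∀
    q₂ : ∀ N → - (+ 2 * N + 1ℤ) + (+ 2 * N + 1ℤ) ≡ 0ℤ
    q₂ = solve-∀

  k-below-λ : ∀ C K → C ≡ N + J + 1ℤ
    → Cone (C - + 2 * K) C × Cone (+ 2 * K + + 2 - C) (- C)
    → K ≡ N + + 2 * J + 1ℤ
  k-below-λ _ K refl (h2a , h2b) =
    pin K (N + + 2 * J + 1ℤ)
      (certificate (+ 8) (times-√5-1 (times-√5-1 frac<1) ⊞ scale (+ 4) h2a) (p₁ N J K) (q₁ N J))
      (certificate (+ 8) (times-√5-1 (times-√5-1 frac>0) ⊞ scale (+ 4) √5-1 ⊞ scale (+ 4) h2b) (p₂ N J K) (q₂ N J))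
    where
    p₁ : ∀ N J K → (+ 5 * ((+ 2 * J + + 2 - N) - (- N)) - (+ 5 * (- N) - (+ 2 * J + + 2 - N)))
                   + + 4 * (N + J + 1ℤ - + 2 * K)
                 ≡ + 8 * (N + + 2 * J + 1ℤ + 1ℤ - K)
    p₁ = solve-∀
    q₁ : ∀ N J → ((+ 5 * (- N) - (+ 2 * J + + 2 - N)) - ((+ 2 * J + + 2 - N) - (- N)))
                 + + 4 * (N + J + 1ℤ) ≡ 0ℤ
    q₁ = solve-∀
    p₂ : ∀ N J K → (+ 5 * ((N - + 2 * J) - N) - (+ 5 * N - (N - + 2 * J))) + + 4 * (- + 1)
                   + + 4 * (+ 2 * K + + 2 - (N + J + 1ℤ))
                 ≡ + 8 * (K - (N + + 2 * J + 1ℤ) + 1ℤ)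
    p₂ = solve-∀
    q₂ : ∀ N J → ((+ 5 * N - (N - + 2 * J)) - ((N - + 2 * J) - N)) + + 4 * + 1
                 + + 4 * (- (N + J + 1ℤ)) ≡ 0ℤ
    q₂ = solve-∀

  k-above-λ : ∀ C K → C ≡ N + J + + 2
    → Cone (C - + 2 * K) C × Cone (+ 2 * K + + 2 - C) (- C)
    → K ≡ N + + 2 * J + + 3
  k-above-λ _ K refl (h2a , h2b) =
    pin K (N + + 2 * J + + 3)
      (certificate (+ 8) (times-√5-1 (times-√5-1 frac<1) ⊞ scale (+ 4) 3-√5 ⊞ scale (+ 4) h2a) (p₁ N J K) (q₁ N J))
      (certificate (+ 8) (times-√5-1 (times-√5-1 frac>0) ⊞ scale (+ 8) √5-2 ⊞ scale (+ 4) h2b) (p₂ N J K) (q₂ N J))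
    where
    p₁ : ∀ N J K → (+ 5 * ((+ 2 * J + + 2 - N) - (- N)) - (+ 5 * (- N) - (+ 2 * J + + 2 - N)))
                   + + 4 * + 3 + + 4 * (N + J + + 2 - + 2 * K)
                 ≡ + 8 * (N + + 2 * J + + 3 + 1ℤ - K)
    p₁ = solve-∀
    q₁ : ∀ N J → ((+ 5 * (- N) - (+ 2 * J + + 2 - N)) - ((+ 2 * J + + 2 - N) - (- N)))
                 + + 4 * (- + 1) + + 4 * (N + J + + 2) ≡ 0ℤ
    q₁ = solve-∀
    p₂ : ∀ N J K → (+ 5 * ((N - + 2 * J) - N) - (+ 5 * N - (N - + 2 * J))) + + 8 * (- + 2)
                   + + 4 * (+ 2 * K + + 2 - (N + J + + 2))
                 ≡ + 8 * (K - (N + + 2 * J + + 3) + 1ℤ)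
    p₂ = solve-∀
    q₂ : ∀ N J → ((+ 5 * N - (N - + 2 * J)) - ((N - + 2 * J) - N)) + + 8 * + 1
                 + + 4 * (- (N + J + + 2)) ≡ 0ℤ
    q₂ = solve-∀

difference : ℤφ → ℤφ → ℤφ
difference f g = φ ⊗ φ ⊗ φ ⊗ g ⊖ φ ⊗ f

closing-below-λ : ∀ N J C K → C ≡ N + J + 1ℤ → K ≡ N + + 2 * J + 1ℤ
                → difference ⟨ - J , N ⟩ ⟨ - K , C ⟩ ≡ φ ⊗ φ
closing-below-λ N J _ _ refl refl = cong₂ ⟨_,_⟩ (e₁ N J) (e₂ N J)
  where
  e₁ : ∀ N J → (+ 1 * - (N + + 2 * J + 1ℤ) + + 2 * (N + J + 1ℤ)) - (0ℤ * - J + 1ℤ * N) ≡ 1ℤ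
  e₁ = solve-∀
  e₂ : ∀ N J → (+ 1 * (N + J + 1ℤ) + + 2 * - (N + + 2 * J + 1ℤ) + + 2 * (N + J + 1ℤ))
               - (0ℤ * N + 1ℤ * - J + 1ℤ * N) ≡ 1ℤ
  e₂ = solve-∀

closing-above-λ : ∀ N J C K → C ≡ N + J + + 2 → K ≡ N + + 2 * J + + 3
                → difference ⟨ - J , N ⟩ ⟨ - K , C ⟩ ≡ ι 1ℤ
closing-above-λ N J _ _ refl refl = cong₂ ⟨_,_⟩ (e₁ N J) (e₂ N J)
  where
  e₁ : ∀ N J → (+ 1 * - (N + + 2 * J + + 3) + + 2 * (N + J + + 2)) - (0ℤ * - J + 1ℤ * N) ≡ 1ℤ
  e₁ = solve-∀
  e₂ : ∀ N J → (+ 1 * (N + J + + 2) + + 2 * - (N + + 2 * J + + 3) + + 2 * (N + J + + 2))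
               - (0ℤ * N + 1ℤ * - J + 1ℤ * N) ≡ 0ℤ
  e₂ = solve-∀

odd : ∀ n → + (2 Data.Nat.* n Data.Nat.+ 1) ≡ + 2 * + n + 1ℤ
odd n = trans (ℤP.pos-+ (2 Data.Nat.* n) 1) (cong (_+ 1ℤ) (ℤP.pos-* 2 n))

lemma3p9 : (n : ℕ) → 1 ≤ n → (c k j : ℤ)
    → IsFloorHalf (ι (+ (2 Data.Nat.* n Data.Nat.+ 1)) ⊗ (φ ⊗ φ)) c
    → IsFloor (ι c ⊗ φ) k
    → IsFloor (ι (+ n) ⊗ φ) j
    → (ι (+ 2) ⊗ (ι (+ n) ⊗ φ ⊖ ι j) <φ ι (+ 3) ⊖ φ
        → φ ⊗ φ ⊗ φ ⊗ (ι c ⊗ φ ⊖ ι k) ⊖ φ ⊗ (ι (+ n) ⊗ φ ⊖ ι j) ≡ φ ⊗ φ)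
      × (ι (+ 3) ⊖ φ <φ ι (+ 2) ⊗ (ι (+ n) ⊗ φ ⊖ ι j)
        → φ ⊗ φ ⊗ φ ⊗ (ι c ⊗ φ ⊖ ι k) ⊖ φ ⊗ (ι (+ n) ⊗ φ ⊖ ι j) ≡ ι 1ℤ)
lemma3p9 (suc m) _ c k j c-floor k-floor j-floor = below-λ , above-λ
  where
  N = + suc m
  nφ-bounds = floor-mφ (λ ()) j-floor
  open Pinning N j (proj₁ nφ-bounds) (proj₂ nφ-bounds)
  c-bounds = floorHalf-mφ² (λ ()) (subst (λ M → IsFloorHalf (ι M ⊗ (φ ⊗ φ)) c) (odd (suc m)) c-floor)
  k-bounds = floor-mφ (c≢0 (positive N) (proj₂ c-bounds)) k-floor

  below-λ : ι (+ 2) ⊗ (ι N ⊗ φ ⊖ ι j) <φ ι (+ 3) ⊖ φ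
          → difference (ι N ⊗ φ ⊖ ι j) (ι c ⊗ φ ⊖ ι k) ≡ φ ⊗ φ
  below-λ hA = subst₂ (λ f g → difference f g ≡ φ ⊗ φ) (sym (fractional N j)) (sym (fractional c k))
                      (closing-below-λ N j c k c≡ (k-below-λ c k c≡ k-bounds))
    where
    c≡ = c-below-λ c c-bounds (twice-below-3-φ { - j} {N} (subst (λ f → ι (+ 2) ⊗ f <φ ι (+ 3) ⊖ φ) (fractional N j) hA))

  above-λ : ι (+ 3) ⊖ φ <φ ι (+ 2) ⊗ (ι N ⊗ φ ⊖ ι j)
          → difference (ι N ⊗ φ ⊖ ι j) (ι c ⊗ φ ⊖ ι k) ≡ ι 1ℤ
  above-λ hB = subst₂ (λ f g → difference f g ≡ ι 1ℤ) (sym (fractional N j)) (sym (fractional c k))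
                      (closing-above-λ N j c k c≡ (k-above-λ c k c≡ k-bounds))
    where
    c≡ = c-above-λ c c-bounds (twice-above-3-φ { - j} {N} (subst (λ f → ι (+ 3) ⊖ φ <φ ι (+ 2) ⊗ f) (fractional N j) hB))
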